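{- Let $q\in\mathbb{Z}[\frac{1+\sqrt5}{2}]$. Then for every positive integer $x$, \[v_2(q^x+1)\in\{0,\,1,\,v_2(q+1),\,v_2(q^3+1)\}.\]
   Context: Since $2$ is inert in $\mathbb{Q}(\sqrt5)$, $v_2$ denotes the $2$-adic valuation on $\mathbb{Q}(\sqrt5)$ (extended to $\mathbb{Q}_2(\sqrt5)$), normalized by $v_2(2)=1$, with $v_2(0)=\infty$. -}

module Defs where

open import Data.Nat using (ℕ; zero; suc)
open import Data.Integer using (ℤ; +_) renaming (_+_ to _+ℤ_; _*_ to _*ℤ_)
open import Data.Product using (Σ; _×_)
open import Relation.Binary.PropositionalEquality using (_≡_)
open import Relation.Nullary using (¬_)

-- The ring ℤ[φ], φ = (1+√5)/2, φ² = φ + 1.  An element is a + b·φ.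
record ℤφ : Set where
  constructor _+_φ
  field
    re : ℤ
    ph : ℤ
open ℤφ public

infixl 6 _⊕_
infixl 7 _⊗_

_⊕_ : ℤφ → ℤφ → ℤφ
(a + b φ) ⊕ (c + d φ) = (a +ℤ c) + (b +ℤ d) φ

-- (a + bφ)(c + dφ) = (ac + bd) + (ad + bc + bd)φ   using φ² = φ + 1
_⊗_ : ℤφ → ℤφ → ℤφ
(a + b φ) ⊗ (c + d φ) = ((a *ℤ c) +ℤ (b *ℤ d)) + ((a *ℤ d) +ℤ (b *ℤ c) +ℤ (b *ℤ d)) φ

𝟙 : ℤφ
𝟙 = (+ 1) + (+ 0) φ

embℕ : ℕ → ℤφ
embℕ n = (+ n) + (+ 0) φ

_^φ_ : ℤφ → ℕ → ℤφ
q ^φ zero = 𝟙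
q ^φ suc n = q ⊗ (q ^φ n)

_∣φ_ : ℤφ → ℤφ → Set
α ∣φ β = Σ ℤφ (λ γ → β ≡ α ⊗ γ)

2^_∣φ_ : ℕ → ℤφ → Set
2^ k ∣φ α = embℕ (2 Data.Nat.^ k) ∣φ α
  where import Data.Nat

-- v₂(α) = v₂(β) in ℕ ∪ {∞}
SameV₂ : ℤφ → ℤφ → Set
SameV₂ α β = (k : ℕ) → (2^ k ∣φ α → 2^ k ∣φ β) × (2^ k ∣φ β → 2^ k ∣φ α)

V₂≡ : ℤφ → ℕ → Set
V₂≡ α k = 2^ k ∣φ α × ¬ (2^ suc k ∣φ α)

{-# OPTIONS --safe #-}
-- Modulo 2, ℤ[φ] is the field 𝔽₄ = {0, 1, φ, φ²}.  If q ≡ 0, then q^x + 1 is a unit mod 2.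
-- If q ≡ 1 mod 2, then for even x we get q^x ≡ 1 mod 4, so v₂(q^x + 1) = 1, while for odd x
-- q^x + 1 = (q + 1)(1 - q + q² - ⋯ + q^(x-1)) and the cofactor, a sum of x odd terms, is odd,
-- so v₂(q^x + 1) = v₂(q + 1).  If q ≡ φ or φ², then q³ ≡ 1 mod 2: for 3 ∣ x the previous case
-- applies to q³, and otherwise q^x + 1 ≡ q + 1 or q² + 1, which are odd.

module Submission where

open import Defs
open import Level using (0ℓ)
open import Algebra.Bundles using (CommutativeRing)
open import Data.Nat as ℕ using (ℕ; zero; suc; _*_; s≤s)
import Data.Nat.Divisibility as ℕ
open import Data.Nat.DivMod using (DivMod; result; _divMod_)
open import Data.Fin using (zero; suc)
open import Data.Integer using (+_; -_; ∣_∣) renaming (_+_ to _+ℤ_; _*_ to _*ℤ_; _≟_ to _≟ℤ_)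
import Data.Integer.Properties as ℤ
open import Data.Integer.Divisibility using () renaming (_∣_ to _∣ℤ_)
open import Data.Integer.DivMod using (_/ℕ_; _%ℕ_; n%ℕd<d; a≡a%ℕn+[a/ℕn]*n)
open import Data.Integer.Tactic.RingSolver using () renaming (solve-∀ to ℤ-solve-∀)
open import Data.Maybe using (Maybe; just; nothing)
open import Data.Product using (_,_)
open import Data.Sum using (_⊎_; inj₁; inj₂)
import Data.Sum as Sum
open import Relation.Nullary using (¬_; yes)
open import Relation.Nullary.Decidable using (from-no)
open import Relation.Binary.PropositionalEquality
open import Tactic.RingSolver using (solve-∀)
import Tactic.RingSolver.Core.AlmostCommutativeRing as ACR

ℤφ-ext : ∀ {α β : ℤφ} → re α ≡ re β → ph α ≡ ph β → α ≡ β
ℤφ-ext refl refl = refl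

𝟘 : ℤφ
𝟘 = (+ 0) + (+ 0) φ

infix 8 ⊖_
⊖_ : ℤφ → ℤφ
⊖ (a + b φ) = (- a) + (- b) φ

⊕-comm : ∀ α β → α ⊕ β ≡ β ⊕ α
⊕-comm (a + b φ) (c + d φ) = ℤφ-ext (ℤ.+-comm a c) (ℤ.+-comm b d)

⊕-assoc : ∀ α β γ → (α ⊕ β) ⊕ γ ≡ α ⊕ (β ⊕ γ)
⊕-assoc (a + b φ) (c + d φ) (e + f φ) = ℤφ-ext (ℤ.+-assoc a c e) (ℤ.+-assoc b d f)

⊕-identityˡ : ∀ α → 𝟘 ⊕ α ≡ α
⊕-identityˡ (a + b φ) = ℤφ-ext (ℤ.+-identityˡ a) (ℤ.+-identityˡ b)

⊕-identityʳ : ∀ α → α ⊕ 𝟘 ≡ α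
⊕-identityʳ (a + b φ) = ℤφ-ext (ℤ.+-identityʳ a) (ℤ.+-identityʳ b)

⊖-inverseˡ : ∀ α → ⊖ α ⊕ α ≡ 𝟘
⊖-inverseˡ (a + b φ) = ℤφ-ext (ℤ.+-inverseˡ a) (ℤ.+-inverseˡ b)

⊖-inverseʳ : ∀ α → α ⊕ ⊖ α ≡ 𝟘
⊖-inverseʳ (a + b φ) = ℤφ-ext (ℤ.+-inverseʳ a) (ℤ.+-inverseʳ b)

⊗-comm : ∀ α β → α ⊗ β ≡ β ⊗ α
⊗-comm (a + b φ) (c + d φ) = ℤφ-ext (re-comm a b c d) (ph-comm a b c d)
  where
  re-comm : ∀ a b c d → a *ℤ c +ℤ b *ℤ d ≡ c *ℤ a +ℤ d *ℤ b
  re-comm = ℤ-solve-∀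
  ph-comm : ∀ a b c d → a *ℤ d +ℤ b *ℤ c +ℤ b *ℤ d ≡ c *ℤ b +ℤ d *ℤ a +ℤ d *ℤ b
  ph-comm = ℤ-solve-∀

⊗-assoc : ∀ α β γ → (α ⊗ β) ⊗ γ ≡ α ⊗ (β ⊗ γ)
⊗-assoc (a + b φ) (c + d φ) (e + f φ) = ℤφ-ext (re-assoc a b c d e f) (ph-assoc a b c d e f)
  where
  re-assoc : ∀ a b c d e f →
    (a *ℤ c +ℤ b *ℤ d) *ℤ e +ℤ (a *ℤ d +ℤ b *ℤ c +ℤ b *ℤ d) *ℤ f
    ≡ a *ℤ (c *ℤ e +ℤ d *ℤ f) +ℤ b *ℤ (c *ℤ f +ℤ d *ℤ e +ℤ d *ℤ f)
  re-assoc = ℤ-solve-∀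
  ph-assoc : ∀ a b c d e f →
    (a *ℤ c +ℤ b *ℤ d) *ℤ f +ℤ (a *ℤ d +ℤ b *ℤ c +ℤ b *ℤ d) *ℤ e +ℤ (a *ℤ d +ℤ b *ℤ c +ℤ b *ℤ d) *ℤ f
    ≡ a *ℤ (c *ℤ f +ℤ d *ℤ e +ℤ d *ℤ f) +ℤ b *ℤ (c *ℤ e +ℤ d *ℤ f) +ℤ b *ℤ (c *ℤ f +ℤ d *ℤ e +ℤ d *ℤ f)
  ph-assoc = ℤ-solve-∀

⊗-identityˡ : ∀ α → 𝟙 ⊗ α ≡ α
⊗-identityˡ (a + b φ) = ℤφ-ext (re-identity a b) (ph-identity a b)
  where
  re-identity : ∀ a b → + 1 *ℤ a +ℤ + 0 *ℤ b ≡ a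
  re-identity = ℤ-solve-∀
  ph-identity : ∀ a b → + 1 *ℤ b +ℤ + 0 *ℤ a +ℤ + 0 *ℤ b ≡ b
  ph-identity = ℤ-solve-∀

⊗-identityʳ : ∀ α → α ⊗ 𝟙 ≡ α
⊗-identityʳ α = trans (⊗-comm α 𝟙) (⊗-identityˡ α)

⊗-distribˡ-⊕ : ∀ α β γ → α ⊗ (β ⊕ γ) ≡ α ⊗ β ⊕ α ⊗ γ
⊗-distribˡ-⊕ (a + b φ) (c + d φ) (e + f φ) = ℤφ-ext (re-distrib a b c d e f) (ph-distrib a b c d e f)
  where
  re-distrib : ∀ a b c d e f →
    a *ℤ (c +ℤ e) +ℤ b *ℤ (d +ℤ f) ≡ (a *ℤ c +ℤ b *ℤ d) +ℤ (a *ℤ e +ℤ b *ℤ f)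
  re-distrib = ℤ-solve-∀
  ph-distrib : ∀ a b c d e f →
    a *ℤ (d +ℤ f) +ℤ b *ℤ (c +ℤ e) +ℤ b *ℤ (d +ℤ f)
    ≡ (a *ℤ d +ℤ b *ℤ c +ℤ b *ℤ d) +ℤ (a *ℤ f +ℤ b *ℤ e +ℤ b *ℤ f)
  ph-distrib = ℤ-solve-∀

⊗-distribʳ-⊕ : ∀ α β γ → (β ⊕ γ) ⊗ α ≡ β ⊗ α ⊕ γ ⊗ α
⊗-distribʳ-⊕ α β γ = begin
  (β ⊕ γ) ⊗ α     ≡⟨ ⊗-comm (β ⊕ γ) α ⟩
  α ⊗ (β ⊕ γ)     ≡⟨ ⊗-distribˡ-⊕ α β γ ⟩
  α ⊗ β ⊕ α ⊗ γ   ≡⟨ cong₂ _⊕_ (⊗-comm α β) (⊗-comm α γ) ⟩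
  β ⊗ α ⊕ γ ⊗ α   ∎
  where open ≡-Reasoning

ℤφ-commutativeRing : CommutativeRing 0ℓ 0ℓ
ℤφ-commutativeRing = record
  { Carrier = ℤφ ; _≈_ = _≡_ ; _+_ = _⊕_ ; _*_ = _⊗_ ; -_ = ⊖_ ; 0# = 𝟘 ; 1# = 𝟙
  ; isCommutativeRing = record
    { isRing = record
      { +-isAbelianGroup = record
        { isGroup = record
          { isMonoid = record
            { isSemigroup = record
              { isMagma = record { isEquivalence = isEquivalence ; ∙-cong = cong₂ _⊕_ }
              ; assoc = ⊕-assoc }
            ; identity = ⊕-identityˡ , ⊕-identityʳ }
          ; inverse = ⊖-inverseˡ , ⊖-inverseʳ
          ; ⁻¹-cong = cong ⊖_ }
        ; comm = ⊕-comm }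
      ; *-cong = cong₂ _⊗_
      ; *-assoc = ⊗-assoc
      ; *-identity = ⊗-identityˡ , ⊗-identityʳ
      ; distrib = ⊗-distribˡ-⊕ , ⊗-distribʳ-⊕ }
    ; *-comm = ⊗-comm } }

ℤφ-ring : ACR.AlmostCommutativeRing 0ℓ 0ℓ
ℤφ-ring = ACR.fromCommutativeRing ℤφ-commutativeRing 𝟘≟
  where
  𝟘≟ : ∀ α → Maybe (𝟘 ≡ α)
  𝟘≟ (a + b φ) with + 0 ≟ℤ a | + 0 ≟ℤ b
  ... | yes refl | yes refl = just refl
  ... | _        | _        = nothing

two : ℤφ
two = 𝟙 ⊕ 𝟙

ϕ : ℤφ
ϕ = (+ 0) + (+ 1) φ

𝟙-^φ : ∀ n → 𝟙 ^φ n ≡ 𝟙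
𝟙-^φ zero    = refl
𝟙-^φ (suc n) = trans (⊗-identityˡ _) (𝟙-^φ n)

^φ-distribˡ-+-⊗ : ∀ q m n → q ^φ (m ℕ.+ n) ≡ q ^φ m ⊗ q ^φ n
^φ-distribˡ-+-⊗ q zero    n = sym (⊗-identityˡ _)
^φ-distribˡ-+-⊗ q (suc m) n = trans (cong (q ⊗_) (^φ-distribˡ-+-⊗ q m n)) (sym (⊗-assoc q _ _))

^φ-*-assoc : ∀ q m n → (q ^φ m) ^φ n ≡ q ^φ (n * m)
^φ-*-assoc q m zero    = refl
^φ-*-assoc q m (suc n) = trans (cong (q ^φ m ⊗_) (^φ-*-assoc q m n)) (sym (^φ-distribˡ-+-⊗ q m (n * m)))

∣φ-trans : ∀ {δ ε α} → δ ∣φ ε → ε ∣φ α → δ ∣φ α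
∣φ-trans {δ} (γ , refl) (γ′ , refl) = γ ⊗ γ′ , ⊗-assoc δ γ γ′

∣φ⇒∣φ⊗ : ∀ {δ α} β → δ ∣φ α → δ ∣φ (α ⊗ β)
∣φ⇒∣φ⊗ {δ} β (γ , refl) = γ ⊗ β , ⊗-assoc δ γ β

∣φ⊕∣φ⇒∣φ : ∀ {δ α β} → δ ∣φ (α ⊕ β) → δ ∣φ β → δ ∣φ α
∣φ⊕∣φ⇒∣φ {δ} {α} (γ , α⊕δγ′≡δγ) (γ′ , refl) = γ ⊕ ⊖ γ′ , (begin
  α                          ≡⟨ cancel α (δ ⊗ γ′) ⟩
  (α ⊕ δ ⊗ γ′) ⊕ ⊖ (δ ⊗ γ′)  ≡⟨ cong (_⊕ ⊖ (δ ⊗ γ′)) α⊕δγ′≡δγ ⟩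
  δ ⊗ γ ⊕ ⊖ (δ ⊗ γ′)         ≡⟨ factor δ γ γ′ ⟩
  δ ⊗ (γ ⊕ ⊖ γ′)             ∎)
  where
  open ≡-Reasoning
  cancel : ∀ α β → α ≡ (α ⊕ β) ⊕ ⊖ β
  cancel = solve-∀ ℤφ-ring
  factor : ∀ δ γ γ′ → δ ⊗ γ ⊕ ⊖ (δ ⊗ γ′) ≡ δ ⊗ (γ ⊕ ⊖ γ′)
  factor = solve-∀ ℤφ-ring

re-two⊗ : ∀ α → re (two ⊗ α) ≡ + 2 *ℤ re α
re-two⊗ (a + b φ) = ℤ.+-identityʳ (+ 2 *ℤ a)

ph-two⊗ : ∀ α → ph (two ⊗ α) ≡ + 2 *ℤ ph α
ph-two⊗ (a + b φ) = trans (ℤ.+-identityʳ _) (ℤ.+-identityʳ (+ 2 *ℤ b))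

two⊗-injective : ∀ {α β} → two ⊗ α ≡ two ⊗ β → α ≡ β
two⊗-injective {α} {β} e = ℤφ-ext
  (ℤ.*-cancelˡ-≡ (+ 2) (re α) (re β) (trans (sym (re-two⊗ α)) (trans (cong re e) (re-two⊗ β))))
  (ℤ.*-cancelˡ-≡ (+ 2) (ph α) (ph β) (trans (sym (ph-two⊗ α)) (trans (cong ph e) (ph-two⊗ β))))

2∣2* : ∀ c → + 2 ∣ℤ + 2 *ℤ c
2∣2* c = subst (2 ℕ.∣_) (sym (ℤ.abs-* (+ 2) c)) (ℕ.m∣m*n ∣ c ∣)

¬2∣φ-of-odd-re : ∀ {α} → ¬ + 2 ∣ℤ re α → ¬ 2^ 1 ∣φ α
¬2∣φ-of-odd-re ¬2∣a (γ , refl) = ¬2∣a (subst (+ 2 ∣ℤ_) (sym (re-two⊗ γ)) (2∣2* (re γ)))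

¬2∣φ-of-odd-ph : ∀ {α} → ¬ + 2 ∣ℤ ph α → ¬ 2^ 1 ∣φ α
¬2∣φ-of-odd-ph ¬2∣b (γ , refl) = ¬2∣b (subst (+ 2 ∣ℤ_) (sym (ph-two⊗ γ)) (2∣2* (ph γ)))

¬2∣φ𝟙 : ¬ 2^ 1 ∣φ 𝟙
¬2∣φ𝟙 = ¬2∣φ-of-odd-re (from-no (2 ℕ.∣? 1))

two^ : ℕ → ℤφ
two^ k = embℕ (2 ℕ.^ k)

two^-suc : ∀ k → two^ (suc k) ≡ two ⊗ two^ k
two^-suc k = ℤφ-ext (trans (ℤ.pos-* 2 (2 ℕ.^ k)) (sym (ℤ.+-identityʳ _))) refl

2^suc∣⇒2^∣ : ∀ {k α} → 2^ suc k ∣φ α → 2^ k ∣φ α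
2^suc∣⇒2^∣ {k} = ∣φ-trans {two^ k} {two^ (suc k)} (two , trans (two^-suc k) (⊗-comm two (two^ k)))

2^∣⇒2^suc∣two⊗ : ∀ {k β} → 2^ k ∣φ β → 2^ suc k ∣φ (two ⊗ β)
2^∣⇒2^suc∣two⊗ {k} (γ , refl) =
  γ , trans (sym (⊗-assoc two (two^ k) γ)) (cong (_⊗ γ) (sym (two^-suc k)))

2^suc∣two⊗⇒2^∣ : ∀ {k β} → 2^ suc k ∣φ (two ⊗ β) → 2^ k ∣φ β
2^suc∣two⊗⇒2^∣ {k} (γ , e) =
  γ , two⊗-injective (trans e (trans (cong (_⊗ γ) (two^-suc k)) (⊗-assoc two (two^ k) γ)))

infix 4 _≡_mod_
record _≡_mod_ (α β γ : ℤφ) : Set where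
  constructor _,_
  field
    multiplier : ℤφ
    equation   : α ≡ β ⊕ γ ⊗ multiplier

-- Opaque so that Agda's injectivity analysis of recursive definitions built from these laws
-- does not unfold the ring-solver proofs, which is prohibitively slow.
opaque
  ≡mod-refl : ∀ {α γ} → α ≡ α mod γ
  ≡mod-refl {α} {γ} = 𝟘 , lemma α γ
    where
    lemma : ∀ α γ → α ≡ α ⊕ γ ⊗ 𝟘
    lemma = solve-∀ ℤφ-ring

  ≡mod-trans : ∀ {α β β′ γ} → α ≡ β mod γ → β ≡ β′ mod γ → α ≡ β′ mod γ
  ≡mod-trans {β′ = β′} {γ} (s , refl) (s′ , refl) = s′ ⊕ s , lemma β′ γ s s′
    where
    lemma : ∀ β′ γ s s′ → (β′ ⊕ γ ⊗ s′) ⊕ γ ⊗ s ≡ β′ ⊕ γ ⊗ (s′ ⊕ s)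
    lemma = solve-∀ ℤφ-ring

  ≡mod-⊕ : ∀ {α α′ β β′ γ} → α ≡ α′ mod γ → β ≡ β′ mod γ → α ⊕ β ≡ α′ ⊕ β′ mod γ
  ≡mod-⊕ {α′ = α′} {β′ = β′} {γ} (s , refl) (s′ , refl) = s ⊕ s′ , lemma α′ β′ γ s s′
    where
    lemma : ∀ α′ β′ γ s s′ → (α′ ⊕ γ ⊗ s) ⊕ (β′ ⊕ γ ⊗ s′) ≡ (α′ ⊕ β′) ⊕ γ ⊗ (s ⊕ s′)
    lemma = solve-∀ ℤφ-ring

  ≡mod-⊖ : ∀ {α α′ γ} → α ≡ α′ mod γ → ⊖ α ≡ ⊖ α′ mod γ
  ≡mod-⊖ {α′ = α′} {γ} (s , refl) = ⊖ s , lemma α′ γ s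
    where
    lemma : ∀ α′ γ s → ⊖ (α′ ⊕ γ ⊗ s) ≡ ⊖ α′ ⊕ γ ⊗ ⊖ s
    lemma = solve-∀ ℤφ-ring

  ≡mod-⊗ : ∀ {α α′ β β′ γ} → α ≡ α′ mod γ → β ≡ β′ mod γ → α ⊗ β ≡ α′ ⊗ β′ mod γ
  ≡mod-⊗ {α′ = α′} {β′ = β′} {γ} (s , refl) (s′ , refl) =
    s ⊗ β′ ⊕ α′ ⊗ s′ ⊕ γ ⊗ s ⊗ s′ , lemma α′ β′ γ s s′
    where
    lemma : ∀ α′ β′ γ s s′ →
      (α′ ⊕ γ ⊗ s) ⊗ (β′ ⊕ γ ⊗ s′) ≡ α′ ⊗ β′ ⊕ γ ⊗ (s ⊗ β′ ⊕ α′ ⊗ s′ ⊕ γ ⊗ s ⊗ s′)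
    lemma = solve-∀ ℤφ-ring

  ≡mod-^φ : ∀ {α β γ} → α ≡ β mod γ → ∀ n → α ^φ n ≡ β ^φ n mod γ
  ≡mod-^φ α≡β zero    = ≡mod-refl
  ≡mod-^φ α≡β (suc n) = ≡mod-⊗ α≡β (≡mod-^φ α≡β n)

≡𝟙-mod-^φ : ∀ {α γ} → α ≡ 𝟙 mod γ → ∀ n → α ^φ n ≡ 𝟙 mod γ
≡𝟙-mod-^φ {α} {γ} α≡1 n = subst (λ β → α ^φ n ≡ β mod γ) (𝟙-^φ n) (≡mod-^φ α≡1 n)

∣φ-resp-≡mod : ∀ {δ α β} → δ ∣φ α → α ≡ β mod δ → δ ∣φ β
∣φ-resp-≡mod {δ} δ∣α (s , refl) = ∣φ⊕∣φ⇒∣φ {δ} δ∣α (s , refl)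

¬2∣φ-resp-≡mod : ∀ {α β} → α ≡ β mod two → ¬ 2^ 1 ∣φ β → ¬ 2^ 1 ∣φ α
¬2∣φ-resp-≡mod α≡β ¬2∣β 2∣α = ¬2∣β (∣φ-resp-≡mod {two} 2∣α α≡β)

≡mod-two-parity : ∀ a b → a + b φ ≡ (+ (a %ℕ 2)) + (+ (b %ℕ 2)) φ mod two
≡mod-two-parity a b = s , ℤφ-ext (trans (split a) (cong (+ (a %ℕ 2) +ℤ_) (sym (re-two⊗ s))))
                                  (trans (split b) (cong (+ (b %ℕ 2) +ℤ_) (sym (ph-two⊗ s))))
  where
  s : ℤφ
  s = (a /ℕ 2) + (b /ℕ 2) φ
  split : ∀ a → a ≡ + (a %ℕ 2) +ℤ + 2 *ℤ (a /ℕ 2)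
  split a = trans (a≡a%ℕn+[a/ℕn]*n a 2) (cong (+ (a %ℕ 2) +ℤ_) (ℤ.*-comm (a /ℕ 2) (+ 2)))

residue-mod-two : ∀ q →
  q ≡ 𝟘 mod two ⊎ q ≡ 𝟙 mod two ⊎ q ≡ ϕ mod two ⊎ q ≡ ϕ ⊗ ϕ mod two
residue-mod-two (a + b φ)
  with a %ℕ 2 | b %ℕ 2 | n%ℕd<d a 2 | n%ℕd<d b 2 | ≡mod-two-parity a b
... | 0 | 0 | _ | _ | q≡r = inj₁ q≡r
... | 1 | 0 | _ | _ | q≡r = inj₂ (inj₁ q≡r)
... | 0 | 1 | _ | _ | q≡r = inj₂ (inj₂ (inj₁ q≡r))
... | 1 | 1 | _ | _ | q≡r = inj₂ (inj₂ (inj₂ q≡r))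
... | suc (suc _) | _ | s≤s (s≤s ()) | _ | _
... | _ | suc (suc _) | _ | s≤s (s≤s ()) | _

V₂≡0 : ∀ {α} → ¬ 2^ 1 ∣φ α → V₂≡ α 0
V₂≡0 {α} ¬2∣α = (α , sym (⊗-identityˡ α)) , ¬2∣α

V₂≡1 : ∀ {β} → ¬ 2^ 1 ∣φ β → V₂≡ (two ⊗ β) 1
V₂≡1 {β} ¬2∣β = (β , refl) , λ 4∣2β → ¬2∣β (2^suc∣two⊗⇒2^∣ {1} 4∣2β)

V₂≡1-of-≡two-mod-four : ∀ {α} → α ≡ two mod (two ⊗ two) → V₂≡ α 1
V₂≡1-of-≡two-mod-four (s , refl) =
  subst (λ α → V₂≡ α 1) (sym (lemma s)) (V₂≡1 (¬2∣φ-resp-≡mod (s , refl) ¬2∣φ𝟙))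
  where
  lemma : ∀ s → two ⊕ two ⊗ two ⊗ s ≡ two ⊗ (𝟙 ⊕ two ⊗ s)
  lemma = solve-∀ ℤφ-ring

SameV₂-⊗-odd : ∀ β {u} → u ≡ 𝟙 mod two → SameV₂ (β ⊗ u) β
SameV₂-⊗-odd β {u} (t , refl) k = divides-β k , ∣φ⇒∣φ⊗ {two^ k} u
  where
  expand : ∀ β t → β ⊗ (𝟙 ⊕ two ⊗ t) ≡ β ⊕ two ⊗ (β ⊗ t)
  expand = solve-∀ ℤφ-ring
  -- 2^(k+1) ∣ β ⊗ u = β ⊕ two ⊗ (β ⊗ t), and 2^k ∣ β makes the second summand divisible too.
  divides-β : ∀ k → 2^ k ∣φ (β ⊗ u) → 2^ k ∣φ β
  divides-β zero    _ = β , sym (⊗-identityˡ β)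
  divides-β (suc k) h = ∣φ⊕∣φ⇒∣φ {two^ (suc k)} (subst (2^ suc k ∣φ_) (expand β t) h)
    (2^∣⇒2^suc∣two⊗ {k} (∣φ⇒∣φ⊗ {two^ k} t (divides-β k (2^suc∣⇒2^∣ {k} h))))

square-≡1-mod-four : ∀ {u} → u ≡ 𝟙 mod two → u ^φ 2 ≡ 𝟙 mod (two ⊗ two)
square-≡1-mod-four (t , refl) = t ⊕ t ⊗ t , lemma t
  where
  lemma : ∀ t → (𝟙 ⊕ two ⊗ t) ⊗ ((𝟙 ⊕ two ⊗ t) ⊗ 𝟙) ≡ 𝟙 ⊕ two ⊗ two ⊗ (t ⊕ t ⊗ t)
  lemma = solve-∀ ℤφ-ring

even-pow-≡1-mod-four : ∀ {u} → u ≡ 𝟙 mod two → ∀ k → u ^φ (k * 2) ≡ 𝟙 mod (two ⊗ two)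
even-pow-≡1-mod-four {u} u≡1 k =
  subst (λ α → α ≡ 𝟙 mod (two ⊗ two)) (^φ-*-assoc u 2 k) (≡𝟙-mod-^φ (square-≡1-mod-four u≡1) k)

alternating-sum : ℤφ → ℕ → ℤφ
alternating-sum u zero    = 𝟙
alternating-sum u (suc k) = 𝟙 ⊕ ⊖ u ⊕ u ⊗ u ⊗ alternating-sum u k

pow-odd⊕𝟙≡⊗alternating-sum : ∀ u k → u ^φ (1 ℕ.+ k * 2) ⊕ 𝟙 ≡ (u ⊕ 𝟙) ⊗ alternating-sum u k
pow-odd⊕𝟙≡⊗alternating-sum u zero    = base u
  where
  base : ∀ u → u ⊗ 𝟙 ⊕ 𝟙 ≡ (u ⊕ 𝟙) ⊗ 𝟙
  base = solve-∀ ℤφ-ring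
pow-odd⊕𝟙≡⊗alternating-sum u (suc k) = begin
  u ⊗ (u ⊗ X) ⊕ 𝟙                                ≡⟨ peel u X ⟩
  (u ⊕ 𝟙) ⊗ (𝟙 ⊕ ⊖ u) ⊕ u ⊗ u ⊗ (X ⊕ 𝟙)          ≡⟨ cong (λ Y → (u ⊕ 𝟙) ⊗ (𝟙 ⊕ ⊖ u) ⊕ u ⊗ u ⊗ Y)
                                                         (pow-odd⊕𝟙≡⊗alternating-sum u k) ⟩
  (u ⊕ 𝟙) ⊗ (𝟙 ⊕ ⊖ u) ⊕ u ⊗ u ⊗ ((u ⊕ 𝟙) ⊗ A)    ≡⟨ collect u A ⟩
  (u ⊕ 𝟙) ⊗ (𝟙 ⊕ ⊖ u ⊕ u ⊗ u ⊗ A)                ∎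
  where
  open ≡-Reasoning
  X A : ℤφ
  X = u ^φ (1 ℕ.+ k * 2)
  A = alternating-sum u k
  peel : ∀ u X → u ⊗ (u ⊗ X) ⊕ 𝟙 ≡ (u ⊕ 𝟙) ⊗ (𝟙 ⊕ ⊖ u) ⊕ u ⊗ u ⊗ (X ⊕ 𝟙)
  peel = solve-∀ ℤφ-ring
  collect : ∀ u A → (u ⊕ 𝟙) ⊗ (𝟙 ⊕ ⊖ u) ⊕ u ⊗ u ⊗ ((u ⊕ 𝟙) ⊗ A) ≡ (u ⊕ 𝟙) ⊗ (𝟙 ⊕ ⊖ u ⊕ u ⊗ u ⊗ A)
  collect = solve-∀ ℤφ-ring

alternating-sum-≡1 : ∀ {u} → u ≡ 𝟙 mod two → ∀ k → alternating-sum u k ≡ 𝟙 mod two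
alternating-sum-≡1 u≡1 zero    = ≡mod-refl
alternating-sum-≡1 u≡1 (suc k) =
  ≡mod-⊕ (≡mod-⊕ (≡mod-refl {𝟙}) (≡mod-⊖ u≡1)) (≡mod-⊗ (≡mod-⊗ u≡1 u≡1) (alternating-sum-≡1 u≡1 k))

v₂-pow⊕𝟙-of-odd : ∀ {u} → u ≡ 𝟙 mod two → ∀ n →
  V₂≡ (u ^φ n ⊕ 𝟙) 1 ⊎ SameV₂ (u ^φ n ⊕ 𝟙) (u ⊕ 𝟙)
v₂-pow⊕𝟙-of-odd {u} u≡1 n with n divMod 2
... | result k zero       refl =
  inj₁ (V₂≡1-of-≡two-mod-four (≡mod-⊕ (even-pow-≡1-mod-four u≡1 k) ≡mod-refl))
... | result k (suc zero) refl =
  inj₂ (subst (λ α → SameV₂ α (u ⊕ 𝟙)) (sym (pow-odd⊕𝟙≡⊗alternating-sum u k))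
              (SameV₂-⊗-odd (u ⊕ 𝟙) (alternating-sum-≡1 u≡1 k)))

V₂-pow⊕𝟙-Cases : ℤφ → ℕ → Set
V₂-pow⊕𝟙-Cases q n =
  V₂≡ (q ^φ n ⊕ 𝟙) 0 ⊎ V₂≡ (q ^φ n ⊕ 𝟙) 1 ⊎ SameV₂ (q ^φ n ⊕ 𝟙) (q ⊕ 𝟙) ⊎ SameV₂ (q ^φ n ⊕ 𝟙) (q ^φ 3 ⊕ 𝟙)

pow-≡-mod-cube : ∀ {q ω γ} → q ≡ ω mod γ → q ^φ 3 ≡ 𝟙 mod γ → ∀ r m → q ^φ (r ℕ.+ m * 3) ≡ ω ^φ r mod γ
pow-≡-mod-cube {q} {ω} {γ} q≡ω q³≡1 r m = subst₂ (λ α β → α ≡ β mod γ)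
  (trans (cong (q ^φ r ⊗_) (^φ-*-assoc q 3 m)) (sym (^φ-distribˡ-+-⊗ q r (m * 3))))
  (⊗-identityʳ (ω ^φ r))
  (≡mod-⊗ (≡mod-^φ q≡ω r) (≡𝟙-mod-^φ q³≡1 m))

v₂-pow⊕𝟙-of-cube-root : ∀ {q ω} → q ≡ ω mod two → ω ^φ 3 ≡ 𝟙 mod two →
  ¬ 2^ 1 ∣φ (ω ^φ 1 ⊕ 𝟙) → ¬ 2^ 1 ∣φ (ω ^φ 2 ⊕ 𝟙) → ∀ n → V₂-pow⊕𝟙-Cases q n
v₂-pow⊕𝟙-of-cube-root {q} {ω} q≡ω ω³≡1 ¬2∣ω+1 ¬2∣ω²+1 n = cases n (n divMod 3)
  where
  q³≡1 : q ^φ 3 ≡ 𝟙 mod two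
  q³≡1 = ≡mod-trans (≡mod-^φ q≡ω 3) ω³≡1
  V₂≡0-of : ∀ r m → ¬ 2^ 1 ∣φ (ω ^φ r ⊕ 𝟙) → V₂≡ (q ^φ (r ℕ.+ m * 3) ⊕ 𝟙) 0
  V₂≡0-of r m ¬2∣ = V₂≡0 (¬2∣φ-resp-≡mod (≡mod-⊕ (pow-≡-mod-cube q≡ω q³≡1 r m) ≡mod-refl) ¬2∣)
  cases : ∀ n → DivMod n 3 → V₂-pow⊕𝟙-Cases q n
  cases _ (result m zero refl) = inj₂ (Sum.map₂ inj₂
    (subst (λ α → V₂≡ (α ⊕ 𝟙) 1 ⊎ SameV₂ (α ⊕ 𝟙) (q ^φ 3 ⊕ 𝟙)) (^φ-*-assoc q 3 m)
           (v₂-pow⊕𝟙-of-odd q³≡1 m)))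
  cases _ (result m (suc zero) refl)       = inj₁ (V₂≡0-of 1 m ¬2∣ω+1)
  cases _ (result m (suc (suc zero)) refl) = inj₁ (V₂≡0-of 2 m ¬2∣ω²+1)

pow-suc⊕𝟙≡𝟙-mod-two : ∀ {q} → q ≡ 𝟘 mod two → ∀ n → q ^φ suc n ⊕ 𝟙 ≡ 𝟙 mod two
pow-suc⊕𝟙≡𝟙-mod-two (s , refl) n = s ⊗ _ , lemma s _
  where
  lemma : ∀ s y → (𝟘 ⊕ two ⊗ s) ⊗ y ⊕ 𝟙 ≡ 𝟙 ⊕ two ⊗ (s ⊗ y)
  lemma = solve-∀ ℤφ-ring

lemma1 : (q : ℤφ) (x : ℕ) →
    V₂≡ ((q ^φ suc x) ⊕ 𝟙) 0 ⊎ V₂≡ ((q ^φ suc x) ⊕ 𝟙) 1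
    ⊎ SameV₂ ((q ^φ suc x) ⊕ 𝟙) (q ⊕ 𝟙) ⊎ SameV₂ ((q ^φ suc x) ⊕ 𝟙) ((q ^φ 3) ⊕ 𝟙)
lemma1 q x with residue-mod-two q
... | inj₁ q≡0 = inj₁ (V₂≡0 (¬2∣φ-resp-≡mod (pow-suc⊕𝟙≡𝟙-mod-two q≡0 x) ¬2∣φ𝟙))
... | inj₂ (inj₁ q≡1) = inj₂ (Sum.map₂ inj₁ (v₂-pow⊕𝟙-of-odd q≡1 (suc x)))
-- ϕ³ = 1 + 2ϕ and (ϕ²)³ = 5 + 8ϕ.
... | inj₂ (inj₂ (inj₁ q≡ϕ)) = v₂-pow⊕𝟙-of-cube-root q≡ϕ (ϕ , refl)
  (¬2∣φ-of-odd-re (from-no (2 ℕ.∣? 1))) (¬2∣φ-of-odd-ph (from-no (2 ℕ.∣? 1))) (suc x)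
... | inj₂ (inj₂ (inj₂ q≡ϕ²)) = v₂-pow⊕𝟙-of-cube-root q≡ϕ² ((+ 2) + (+ 4) φ , refl)
  (¬2∣φ-of-odd-ph (from-no (2 ℕ.∣? 1))) (¬2∣φ-of-odd-re (from-no (2 ℕ.∣? 3))) (suc x)
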